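{- For all integers $k \ge 1$ and $v \ge 1$, \[ \mu(k,v) = \frac{(v+1)^{k+1} - (v+1)}{v}. \]
   Context: All graphs are finite and simple. An interval graph is the intersection graph of a finite family of open intervals of the real line (vertices correspond to intervals, two vertices adjacent iff the intervals intersect). The claw number $\psi(G)$ of a graph $G$ is the largest integer $v \ge 0$ such that the star $K_{1,v}$ is an induced subgraph of $G$. A vertex partition of $G$ into $k$ induced subgraphs means a partition of $V(G)$ into $k$ subsets together with the induced subgraphs on them. For $k \ge 1$ and $v \ge 1$, $\mu(k,v)$ denotes the largest integer $n$ such that every interval graph with $n$ vertices admits a vertex partition into $k$ induced subgraphs each with claw number at most $v$.
   Formalization: The open intervals defining interval graphs have rational endpoints instead of real ones, and two intervals intersect when they share a rational point. -}

module Defs where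

open import Data.Nat using (ℕ; suc; _≤_)
open import Data.Fin using (Fin)
open import Data.Rational using (ℚ; _<_)
open import Data.Product using (Σ; ∃; _×_)
open import Relation.Nullary using (¬_)
open import Relation.Binary.PropositionalEquality using (_≡_; _≢_)
open import Function.Definitions using (Injective)
open import Function.Bundles using (_⇔_)

record Graph (n : ℕ) : Set₁ where
  field
    Adj     : Fin n → Fin n → Set
    symm    : ∀ {i j} → Adj i j → Adj j i
    irrefl  : ∀ {i} → ¬ Adj i i

record OpenInterval : Set where
  constructor ⟨_,_,_⟩
  field
    lo    : ℚ
    hi    : ℚ
    lo<hi : lo < hi

open OpenInterval

_∈ᴵ_ : ℚ → OpenInterval → Set
x ∈ᴵ I = (lo I < x) × (x < hi I)

Intersect : OpenInterval → OpenInterval → Set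
Intersect I J = ∃ λ x → (x ∈ᴵ I) × (x ∈ᴵ J)

IsIntervalGraph : ∀ {n} → Graph n → Set
IsIntervalGraph {n} G =
  Σ (Fin n → OpenInterval) λ I →
    ∀ i j → Graph.Adj G i j ⇔ ((i ≢ j) × Intersect (I i) (I j))

HasInducedStarIn : ∀ {n} → Graph n → (Fin n → Set) → ℕ → Set
HasInducedStarIn {n} G S w =
  Σ (Fin n) λ c → Σ (Fin w → Fin n) λ ℓ →
    S c × (∀ a → S (ℓ a)) × Injective _≡_ _≡_ ℓ
    × (∀ a → Graph.Adj G c (ℓ a))
    × (∀ a b → ¬ Graph.Adj G (ℓ a) (ℓ b))

ClawNumber≤ : ∀ {n} → Graph n → (Fin n → Set) → ℕ → Set
ClawNumber≤ G S v = ∀ w → HasInducedStarIn G S w → w ≤ v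

-- G admits a vertex partition into k induced subgraphs each of claw number ≤ v
-- (a partition into k classes = a map Fin n → Fin k; classes may be empty).
PartitionableClaw : ∀ {n} → Graph n → ℕ → ℕ → Set
PartitionableClaw {n} G k v =
  Σ (Fin n → Fin k) λ col → ∀ (p : Fin k) → ClawNumber≤ G (λ x → col x ≡ p) v

AllIntervalPartitionable : ℕ → ℕ → ℕ → Set₁
AllIntervalPartitionable k v n =
  (G : Graph n) → IsIntervalGraph G → PartitionableClaw G k v

IsLargest : (ℕ → Set₁) → ℕ → Set₁
IsLargest P m = P m × (∀ n → P n → n ≤ m)

-- Write μ k = (v+1)(μ (k-1) + 1), μ 0 = 0; then v μ k + (v+1) = (v+1)^(k+1), which is the stated
-- formula.
--
-- Lower bound, by induction on k with s = μ (k-1). Sweep the intervals from left to right. At a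
-- cut x, chosen as the (s+1)-st smallest right end point, at most s intervals end before x; they
-- form a block, coloured recursively with k-1 colours. The intervals containing points just left
-- of x form a clique and all get the first colour; then the sweep restarts with the intervals lying
-- right of x, which no earlier interval meets. Every cut uses up at least s+1 intervals, the leaves
-- of a star in the first colour lie in distinct cliques, and its centre strictly crosses one of the
-- cuts; so a star with v+1 leaves needs more than (v+1)(s+1) = μ k intervals.
--
-- Upper bound: place v+1 disjoint copies of an extremal family for k-1 colours under one long
-- interval. In a k-colouring either every copy has a vertex of the colour of the long interval,
-- which gives a monochromatic K_{1,v+1}, or some copy avoids that colour and so is coloured with
-- k-1 colours.
module Submission where

open import Defs
open import Data.Nat using (ℕ; suc; _+_; _∸_; _^_; _/_; _≤_; >-nonZero)

open import Level using (0ℓ)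
open import Data.Nat using (zero; _*_; _<_; _⊓_; z≤n; s≤s; s≤s⁻¹; _≤?_; NonZero)
import Data.Nat.Properties as ℕ
open import Data.Nat.DivMod using (m*n/n≡m)
open import Data.Nat.Tactic.RingSolver using (solve-∀)
import Data.Integer as ℤ
import Data.Integer.Properties as ℤ
open import Data.Rational using (ℚ)
import Data.Rational as ℚ
import Data.Rational.Properties as ℚ
open import Data.Rational.Literals using (fromℤ)
open import Data.Fin
  using (Fin; zero; suc; toℕ; remQuot; combine; inject≤; fromℕ<; punchIn; punchOut)
import Data.Fin.Properties as Fin
open import Data.Fin.Subset
  using (Subset; inside; outside; _∈_; _∉_; _⊆_; _⊂_; _∩_; _∪_; ∁; ⁅_⁆; ∣_∣; Nonempty; Empty)
  renaming (⊤ to ∅ᶜ; ⊥ to ∅)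
open import Data.Fin.Subset.Properties
  using ( _∈?_; ∈⊤; ∉⊥; ⊆-min; nonempty?; Empty-unique
        ; ∣⊤∣≡n; ∣⊥∣≡0; ∣⁅x⁆∣≡1; ∣p∩q∣≤∣p∣; p⊆q⇒∣p∣≤∣q∣; p⊂q⇒∣p∣<∣q∣
        ; x∈⁅x⁆; x≢y⇒x∉⁅y⁆; x∈∁p⇒x∉p; x∉p⇒x∈∁p
        ; x∈p∩q⁺; x∈p∩q⁻; x∈p∪q⁺; x∈p∪q⁻ )
open import Data.Fin.Subset.Induction using (⊂-wellFounded)
open import Data.Vec using (tabulate; _∷_; []; here; there)
open import Data.Vec.Properties using (lookup∘tabulate; lookup⇒[]=; []=⇒lookup)
open import Data.Bool using (if_then_else_)
open import Data.Product using (Σ; ∃; _×_; _,_; proj₁; proj₂; swap)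
import Data.Product as Product
open import Data.Sum using (_⊎_; inj₁; inj₂; [_,_]′)
import Data.Sum as Sum
open import Function using (_∘_; id)
open import Function.Bundles using (_⇔_; Equivalence; mk⇔)
import Function.Properties.Equivalence as ⇔
open import Function.Definitions using (Injective)
open import Induction.WellFounded using (module All)
open import Relation.Binary.Definitions using (DecidableEquality; tri<; tri≈; tri>)
open import Relation.Binary.PropositionalEquality
  using (_≡_; _≢_; refl; sym; trans; cong; cong₂; subst; subst₂; module ≡-Reasoning)
open import Relation.Nullary using (¬_; Dec; yes; no; does; contradiction)
open import Relation.Nullary.Decidable using (dec-true; dec-false; decidable-stable; _×-dec_)
open import Relation.Unary using (Pred; Decidable)

private
  variable
    n : ℕ
    p q r : Subset n

-- Finite sets of vertices

-- Opaque, so that unification sees ⟦ P? ⟧ rather than the tabulated vector and can infer P?.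
opaque

  ⟦_⟧ : ∀ {ℓ} {P : Pred (Fin n) ℓ} → Decidable P → Subset n
  ⟦ P? ⟧ = tabulate (does ∘ P?)

  ∈⟦⟧⁺ : ∀ {ℓ} {P : Pred (Fin n) ℓ} (P? : Decidable P) {x} → P x → x ∈ ⟦ P? ⟧
  ∈⟦⟧⁺ P? {x} px = lookup⇒[]= x _ (trans (lookup∘tabulate _ x) (dec-true (P? x) px))

  ∈⟦⟧⁻ : ∀ {ℓ} {P : Pred (Fin n) ℓ} (P? : Decidable P) {x} → x ∈ ⟦ P? ⟧ → P x
  ∈⟦⟧⁻ P? {x} x∈ with P? x | trans (sym (lookup∘tabulate (does ∘ P?) x)) ([]=⇒lookup x∈)
  ... | yes px | _  = px
  ... | no _   | ()

∣p∩q∣+∣p∪q∣≡∣p∣+∣q∣ : ∀ {n} (p q : Subset n) → ∣ p ∩ q ∣ + ∣ p ∪ q ∣ ≡ ∣ p ∣ + ∣ q ∣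
∣p∩q∣+∣p∪q∣≡∣p∣+∣q∣ []            []            = refl
∣p∩q∣+∣p∪q∣≡∣p∣+∣q∣ (outside ∷ p) (outside ∷ q) = ∣p∩q∣+∣p∪q∣≡∣p∣+∣q∣ p q
∣p∩q∣+∣p∪q∣≡∣p∣+∣q∣ (outside ∷ p) (inside  ∷ q) =
  trans (ℕ.+-suc _ _) (trans (cong suc (∣p∩q∣+∣p∪q∣≡∣p∣+∣q∣ p q)) (sym (ℕ.+-suc _ _)))
∣p∩q∣+∣p∪q∣≡∣p∣+∣q∣ (inside  ∷ p) (outside ∷ q) =
  trans (ℕ.+-suc _ _) (cong suc (∣p∩q∣+∣p∪q∣≡∣p∣+∣q∣ p q))
∣p∩q∣+∣p∪q∣≡∣p∣+∣q∣ (inside  ∷ p) (inside  ∷ q) =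
  cong suc (trans (ℕ.+-suc _ _) (trans (cong suc (∣p∩q∣+∣p∪q∣≡∣p∣+∣q∣ p q)) (sym (ℕ.+-suc _ _))))

∈∪⁻ : ∀ {x : Fin n} → x ∈ p ∪ q → x ∈ p ⊎ x ∈ q
∈∪⁻ {p = p} {q = q} = x∈p∪q⁻ p q

∈∩⁻ : ∀ {x : Fin n} → x ∈ p ∩ q → x ∈ p × x ∈ q
∈∩⁻ {p = p} {q = q} = x∈p∩q⁻ p q

Empty⇒∣p∣≡0 : Empty p → ∣ p ∣ ≡ 0
Empty⇒∣p∣≡0 {n} e = trans (cong ∣_∣ (Empty-unique e)) (∣⊥∣≡0 n)

0<∣p∣⇒Nonempty : ∀ (p : Subset n) → 0 < ∣ p ∣ → Nonempty p
0<∣p∣⇒Nonempty p 0<∣p∣ with nonempty? p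
... | yes ne = ne
... | no e   = contradiction (Empty⇒∣p∣≡0 e) (ℕ.>⇒≢ 0<∣p∣)

p⊆q∪r⇒∣p∣≤∣q∣+∣r∣ : p ⊆ q ∪ r → ∣ p ∣ ≤ ∣ q ∣ + ∣ r ∣
p⊆q∪r⇒∣p∣≤∣q∣+∣r∣ {q = q} {r = r} p⊆q∪r = ℕ.≤-trans (p⊆q⇒∣p∣≤∣q∣ p⊆q∪r)
  (subst (∣ q ∪ r ∣ ≤_) (∣p∩q∣+∣p∪q∣≡∣p∣+∣q∣ q r) (ℕ.m≤n+m _ _))

Empty[p∩q]⇒∣p∣+∣q∣≡∣p∪q∣ : Empty (p ∩ q) → ∣ p ∣ + ∣ q ∣ ≡ ∣ p ∪ q ∣
Empty[p∩q]⇒∣p∣+∣q∣≡∣p∪q∣ {p = p} {q = q} e =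
  trans (sym (∣p∩q∣+∣p∪q∣≡∣p∣+∣q∣ p q)) (cong (_+ ∣ p ∪ q ∣) (Empty⇒∣p∣≡0 e))

subsingleton⇒∣p∣≤1 : (∀ {x y} → x ∈ p → y ∈ p → x ≡ y) → ∣ p ∣ ≤ 1
subsingleton⇒∣p∣≤1 {p = p} unique with nonempty? p
... | no e          = ℕ.≤-trans (ℕ.≤-reflexive (Empty⇒∣p∣≡0 e)) z≤n
... | yes (x , x∈p) = subst (∣ p ∣ ≤_) (∣⁅x⁆∣≡1 x)
  (p⊆q⇒∣p∣≤∣q∣ λ y∈p → subst (_∈ ⁅ x ⁆) (unique x∈p y∈p) (x∈⁅x⁆ x))

x∈p⇒0<∣p∣ : ∀ (p : Subset n) {x} → x ∈ p → 0 < ∣ p ∣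
x∈p⇒0<∣p∣ {n} p {x} x∈p =
  subst (_< ∣ p ∣) (∣⊥∣≡0 n) (p⊂q⇒∣p∣<∣q∣ {p = ∅} {q = p} (⊆-min p , x , x∈p , ∉⊥))

p⊆q∪⁅x⁆⇒∣p∣≤1+∣q∣ : ∀ {x : Fin n} → p ⊆ q ∪ ⁅ x ⁆ → ∣ p ∣ ≤ suc ∣ q ∣
p⊆q∪⁅x⁆⇒∣p∣≤1+∣q∣ {q = q} {x = x} p⊆q∪⁅x⁆ = ℕ.≤-trans (p⊆q∪r⇒∣p∣≤∣q∣+∣r∣ p⊆q∪⁅x⁆)
  (ℕ.≤-reflexive (trans (cong (∣ q ∣ +_) (∣⁅x⁆∣≡1 x)) (ℕ.+-comm ∣ q ∣ 1)))

x∈p∧x≢y⇒x∈p∩∁⁅y⁆ : ∀ {x y : Fin n} → y ∈ p → y ≢ x → y ∈ p ∩ ∁ ⁅ x ⁆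
x∈p∧x≢y⇒x∈p∩∁⁅y⁆ y∈p y≢x = x∈p∩q⁺ (y∈p , x∉p⇒x∈∁p (x≢y⇒x∉⁅y⁆ y≢x))

p⊆q∪r⇒∣p∣≤∣p∩q∣+∣p∩r∣ : p ⊆ q ∪ r → ∣ p ∣ ≤ ∣ p ∩ q ∣ + ∣ p ∩ r ∣
p⊆q∪r⇒∣p∣≤∣p∩q∣+∣p∩r∣ p⊆q∪r = p⊆q∪r⇒∣p∣≤∣q∣+∣r∣ λ x∈p →
  [ (λ x∈q → x∈p∪q⁺ (inj₁ (x∈p∩q⁺ (x∈p , x∈q)))) , (λ x∈r → x∈p∪q⁺ (inj₂ (x∈p∩q⁺ (x∈p , x∈r)))) ]′
  (∈∪⁻ (p⊆q∪r x∈p))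

module _ {w n : ℕ} (f : Fin w → Fin n) where

  image : Subset n
  image = ⟦ (λ y → Fin.any? (λ a → f a Fin.≟ y)) ⟧

  ∈image⁺ : ∀ a → f a ∈ image
  ∈image⁺ a = ∈⟦⟧⁺ (λ y → Fin.any? (λ a → f a Fin.≟ y)) (a , refl)

  ∈image-elim : ∀ {ℓ} (P : Fin n → Set ℓ) → (∀ a → P (f a)) → ∀ {y} → y ∈ image → P y
  ∈image-elim P Pf y∈ with ∈⟦⟧⁻ (λ y → Fin.any? (λ a → f a Fin.≟ y)) y∈
  ... | a , refl = Pf a

injective⇒w≤∣image∣ : ∀ {w n} (f : Fin w → Fin n) → Injective _≡_ _≡_ f → w ≤ ∣ image f ∣
injective⇒w≤∣image∣ {zero}  f inj = z≤n
injective⇒w≤∣image∣ {suc w} f inj =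
  ℕ.≤-trans (s≤s (injective⇒w≤∣image∣ (f ∘ suc) (Fin.suc-injective ∘ inj)))
            (p⊂q⇒∣p∣<∣q∣ (image-suc⊆ , f zero , ∈image⁺ f zero , f0∉))
  where
  image-suc⊆ : image (f ∘ suc) ⊆ image f
  image-suc⊆ = ∈image-elim (f ∘ suc) (_∈ image f) (∈image⁺ f ∘ suc)
  f0∉ : f zero ∉ image (f ∘ suc)
  f0∉ f0∈ = ∈image-elim (f ∘ suc) (_≢ f zero) (λ a fa≡f0 → Fin.0≢1+n (sym (inj fa≡f0))) f0∈ refl

module _ {a} {A : Set a} (_≟_ : DecidableEquality A) (f : Fin n → A) (b : A) where

  preimage : Subset n
  preimage = ⟦ (λ y → f y ≟ b) ⟧

  ∈preimage⁺ : ∀ {y} → f y ≡ b → y ∈ preimage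
  ∈preimage⁺ = ∈⟦⟧⁺ (λ y → f y ≟ b)

  ∈preimage⁻ : ∀ {y} → y ∈ preimage → f y ≡ b
  ∈preimage⁻ = ∈⟦⟧⁻ (λ y → f y ≟ b)

<⇒≱ : ∀ {a b} → a ℚ.< b → ¬ b ℚ.≤ a
<⇒≱ a<b b≤a = ℚ.<-irrefl refl (ℚ.<-≤-trans a<b b≤a)

argmin : (h : Fin n → ℚ) → Nonempty p → ∃ λ m → m ∈ p × ∀ {y} → y ∈ p → h m ℚ.≤ h y
argmin {p = inside ∷ p} h _ with nonempty? p
... | no ∅p = zero , here , λ { here → ℚ.≤-refl ; (there y∈p) → contradiction (_ , y∈p) ∅p }
... | yes p≠∅ with argmin (h ∘ suc) p≠∅
...   | m , m∈p , min with ℚ.≤-total (h zero) (h (suc m))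
...     | inj₁ h0≤hm = zero , here , λ { here → ℚ.≤-refl ; (there y∈p) → ℚ.≤-trans h0≤hm (min y∈p) }
...     | inj₂ hm≤h0 = suc m , there m∈p , λ { here → hm≤h0 ; (there y∈p) → min y∈p }
argmin {p = outside ∷ p} h (suc x , there x∈p) with argmin (h ∘ suc) (x , x∈p)
... | m , m∈p , min = suc m , there m∈p , λ { (there y∈p) → min y∈p }

Below AtMost : (Fin n → ℚ) → ℚ → Subset n
Below h x = ⟦ (λ y → h y ℚ.<? x) ⟧
AtMost h x = ⟦ (λ y → h y ℚ.≤? x) ⟧

module _ {h : Fin n → ℚ} {x : ℚ} {y : Fin n} where

  ∈Below⁺ : h y ℚ.< x → y ∈ Below h x
  ∈Below⁺ = ∈⟦⟧⁺ (λ y → h y ℚ.<? x)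

  ∈Below⁻ : y ∈ Below h x → h y ℚ.< x
  ∈Below⁻ = ∈⟦⟧⁻ (λ y → h y ℚ.<? x)

  ∈AtMost⁺ : h y ℚ.≤ x → y ∈ AtMost h x
  ∈AtMost⁺ = ∈⟦⟧⁺ (λ y → h y ℚ.≤? x)

  ∈AtMost⁻ : y ∈ AtMost h x → h y ℚ.≤ x
  ∈AtMost⁻ = ∈⟦⟧⁻ (λ y → h y ℚ.≤? x)

-- The (s+1)-st smallest value of h on p, counted with multiplicity.
threshold : (h : Fin n → ℚ) (s : ℕ) → s < ∣ p ∣ →
            ∃ λ x → ∣ p ∩ Below h x ∣ ≤ s × s < ∣ p ∩ AtMost h x ∣
threshold {p = p} h s s<∣p∣ with argmin h (0<∣p∣⇒Nonempty p (ℕ.≤-<-trans z≤n s<∣p∣))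
threshold {p = p} h zero s<∣p∣ | m , m∈p , min =
  h m , ℕ.≤-reflexive (Empty⇒∣p∣≡0 nothing-below)
      , x∈p⇒0<∣p∣ (p ∩ AtMost h (h m)) (x∈p∩q⁺ (m∈p , ∈AtMost⁺ ℚ.≤-refl))
  where
  nothing-below : Empty (p ∩ Below h (h m))
  nothing-below (y , y∈) with ∈∩⁻ y∈
  ... | y∈p , hy<hm = <⇒≱ (∈Below⁻ hy<hm) (min y∈p)
threshold {p = p} h (suc s) s<∣p∣ | m , m∈p , min
  with threshold {p = p ∩ ∁ ⁅ m ⁆} h s (s≤s⁻¹ (ℕ.≤-trans s<∣p∣ (p⊆q∪⁅x⁆⇒∣p∣≤1+∣q∣ split)))
  where
  split : p ⊆ (p ∩ ∁ ⁅ m ⁆) ∪ ⁅ m ⁆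
  split {y} y∈p with y Fin.≟ m
  ... | yes refl = x∈p∪q⁺ (inj₂ (x∈⁅x⁆ m))
  ... | no y≢m   = x∈p∪q⁺ (inj₁ (x∈p∧x≢y⇒x∈p∩∁⁅y⁆ y∈p y≢m))
... | x , below≤s , s<atMost = x , ℕ.≤-trans (p⊆q∪⁅x⁆⇒∣p∣≤1+∣q∣ split-below) (s≤s below≤s)
                                 , ℕ.<-≤-trans (s≤s s<atMost) (p⊂q⇒∣p∣<∣q∣ (shrink , m , m∈ , m∉))
  where
  split-below : p ∩ Below h x ⊆ ((p ∩ ∁ ⁅ m ⁆) ∩ Below h x) ∪ ⁅ m ⁆
  split-below {y} y∈ with y Fin.≟ m | ∈∩⁻ y∈
  ... | yes refl | _            = x∈p∪q⁺ (inj₂ (x∈⁅x⁆ m))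
  ... | no y≢m   | y∈p , y∈below = x∈p∪q⁺ (inj₁ (x∈p∩q⁺ (x∈p∧x≢y⇒x∈p∩∁⁅y⁆ y∈p y≢m , y∈below)))
  shrink : (p ∩ ∁ ⁅ m ⁆) ∩ AtMost h x ⊆ p ∩ AtMost h x
  shrink y∈ with ∈∩⁻ y∈
  ... | y∈p∖m , y∈atMost = x∈p∩q⁺ (proj₁ (∈∩⁻ y∈p∖m) , y∈atMost)
  m∈ : m ∈ p ∩ AtMost h x
  m∈ with 0<∣p∣⇒Nonempty ((p ∩ ∁ ⁅ m ⁆) ∩ AtMost h x) (ℕ.≤-<-trans z≤n s<atMost)
  ... | y , y∈ with ∈∩⁻ y∈
  ...   | y∈p∖m , hy≤x =
    x∈p∩q⁺ (m∈p , ∈AtMost⁺ (ℚ.≤-trans (min (proj₁ (∈∩⁻ y∈p∖m))) (∈AtMost⁻ hy≤x)))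
  m∉ : m ∉ (p ∩ ∁ ⁅ m ⁆) ∩ AtMost h x
  m∉ m∈ = x∈∁p⇒x∉p (proj₂ (∈∩⁻ (proj₁ (∈∩⁻ m∈)))) (x∈⁅x⁆ m)

-- Intervals and interval graphs

open OpenInterval

<-⊓ : ∀ {a b c} → a ℚ.< b → a ℚ.< c → a ℚ.< b ℚ.⊓ c
<-⊓ {a} {b} {c} a<b a<c =
  [ (λ b⊓c≡b → subst (a ℚ.<_) (sym b⊓c≡b) a<b) , (λ b⊓c≡c → subst (a ℚ.<_) (sym b⊓c≡c) a<c) ]′
  (ℚ.⊓-sel b c)

⊔-< : ∀ {a b c} → a ℚ.< c → b ℚ.< c → a ℚ.⊔ b ℚ.< c
⊔-< {a} {b} {c} a<c b<c =
  [ (λ a⊔b≡a → subst (ℚ._< c) (sym a⊔b≡a) a<c) , (λ a⊔b≡b → subst (ℚ._< c) (sym a⊔b≡b) b<c) ]′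
  (ℚ.⊔-sel a b)

Intersect-sym : ∀ I J → Intersect I J → Intersect J I
Intersect-sym _ _ (x , x∈I , x∈J) = x , x∈J , x∈I

Intersect⇒lo<hi : ∀ I J → Intersect I J → lo I ℚ.< hi J × lo J ℚ.< hi I
Intersect⇒lo<hi _ _ (x , (loI<x , x<hiI) , (loJ<x , x<hiJ)) =
  ℚ.<-trans loI<x x<hiJ , ℚ.<-trans loJ<x x<hiI

lo<hi⇒Intersect : ∀ I J → lo I ℚ.< hi J → lo J ℚ.< hi I → Intersect I J
lo<hi⇒Intersect I J loI<hiJ loJ<hiI
  with ℚ.<-dense (⊔-< (<-⊓ (lo<hi I) loI<hiJ) (<-⊓ loJ<hiI (lo<hi J)))
... | x , los<x , x<his =
  x , (ℚ.≤-<-trans (ℚ.p≤p⊔q (lo I) (lo J)) los<x , ℚ.<-≤-trans x<his (ℚ.p⊓q≤p (hi I) (hi J)))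
    , (ℚ.≤-<-trans (ℚ.p≤q⊔p (lo I) (lo J)) los<x , ℚ.<-≤-trans x<his (ℚ.p⊓q≤q (hi I) (hi J)))

intersectionGraph : (Fin n → OpenInterval) → Graph n
intersectionGraph I = record
  { Adj    = λ x y → x ≢ y × Intersect (I x) (I y)
  ; symm   = λ (x≢y , I∩J) → x≢y ∘ sym , Intersect-sym (I _) (I _) I∩J
  ; irrefl = λ (x≢x , _) → x≢x refl
  }

intersectionGraph-isInterval : (I : Fin n → OpenInterval) → IsIntervalGraph (intersectionGraph I)
intersectionGraph-isInterval I = I , λ _ _ → mk⇔ id id

star-transfer : ∀ {m n w} {G : Graph m} {H : Graph n} {S : Fin m → Set} {T : Fin n → Set}
                (e : Fin m → Fin n) → Injective _≡_ _≡_ e →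
                (∀ {i j} → Graph.Adj G i j ⇔ Graph.Adj H (e i) (e j)) → (∀ {i} → S i → T (e i)) →
                HasInducedStarIn G S w → HasInducedStarIn H T w
star-transfer e e-inj Adj⇔ S⇒T (c , ℓ , c∈S , ℓ∈S , ℓ-inj , c~ℓ , ℓ≁ℓ) =
  e c , e ∘ ℓ , S⇒T c∈S , S⇒T ∘ ℓ∈S , ℓ-inj ∘ e-inj
      , (λ a → Equivalence.to Adj⇔ (c~ℓ a)) , (λ a b → ℓ≁ℓ a b ∘ Equivalence.from Adj⇔)

intersectionGraph-embedding : ∀ {m n} {I : Fin m → OpenInterval} {J : Fin n → OpenInterval}
  (e : Fin m → Fin n) → Injective _≡_ _≡_ e →
  (∀ {i j} → Intersect (I i) (I j) ⇔ Intersect (J (e i)) (J (e j))) →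
  ∀ {i j} → Graph.Adj (intersectionGraph I) i j ⇔ Graph.Adj (intersectionGraph J) (e i) (e j)
intersectionGraph-embedding e e-inj I⇔J = mk⇔
  (λ (i≢j , i∩j) → i≢j ∘ e-inj , Equivalence.to I⇔J i∩j)
  (λ (ei≢ej , ei∩ej) → ei≢ej ∘ cong e , Equivalence.from I⇔J ei∩ej)

module Stars {n : ℕ} (I : Fin n → OpenInterval) where

  Independent : Subset n → Set
  Independent L = ∀ {y z} → y ∈ L → z ∈ L → y ≢ z → ¬ Intersect (I y) (I z)

  record IsStar (X : Subset n) (c : Fin n) (L : Subset n) : Set where
    field
      centre∈     : c ∈ X
      leaves⊆     : L ⊆ X
      centre∉     : c ∉ L
      meets       : ∀ {y} → y ∈ L → Intersect (I c) (I y)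
      independent : Independent L

  open IsStar public

  ClawBounded : ℕ → Subset n → Set
  ClawBounded v X = ∀ {c L} → IsStar X c L → ∣ L ∣ ≤ v

  Colouring : (v k : ℕ) → Subset n → Set
  Colouring v k R = Σ (Fin n → Fin k) λ col → ∀ p → ClawBounded v (R ∩ preimage Fin._≟_ col p)

  IsStar-⊆ : ∀ {X Y c L} → c ∈ Y → L ⊆ Y → IsStar X c L → IsStar Y c L
  IsStar-⊆ c∈Y L⊆Y star = record
    { centre∈     = c∈Y
    ; leaves⊆     = L⊆Y
    ; centre∉     = centre∉ star
    ; meets       = meets star
    ; independent = independent star
    }

  ClawBounded⇒ClawNumber≤ : (G : Graph n) →
                            (∀ i j → Graph.Adj G i j ⇔ (i ≢ j × Intersect (I i) (I j))) →
                            ∀ {S X v} → (∀ {y} → S y → y ∈ X) → ClawBounded v X → ClawNumber≤ G S v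
  ClawBounded⇒ClawNumber≤ G Adj⇔ {X = X} S⊆X bounded w (c , ℓ , c∈S , ℓ∈S , ℓ-inj , c~ℓ , ℓ≁ℓ) =
    ℕ.≤-trans (injective⇒w≤∣image∣ ℓ ℓ-inj) (bounded star)
    where
    adj⇒ : ∀ {i j} → Graph.Adj G i j → i ≢ j × Intersect (I i) (I j)
    adj⇒ = Equivalence.to (Adj⇔ _ _)
    star : IsStar X c (image ℓ)
    star = record
      { centre∈     = S⊆X c∈S
      ; leaves⊆     = ∈image-elim ℓ (_∈ X) (S⊆X ∘ ℓ∈S)
      ; centre∉     = λ c∈ → ∈image-elim ℓ (_≢ c) (λ a → proj₁ (adj⇒ (c~ℓ a)) ∘ sym) c∈ refl
      ; meets       = ∈image-elim ℓ (λ y → Intersect (I c) (I y)) (proj₂ ∘ adj⇒ ∘ c~ℓ)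
      ; independent = λ y∈ z∈ → ∈image-elim ℓ (λ y → y ≢ _ → ¬ Intersect (I y) (I _))
          (λ a → ∈image-elim ℓ (λ z → ℓ a ≢ z → ¬ Intersect (I (ℓ a)) (I z))
            (λ b ℓa≢ℓb ℓa∩ℓb → ℓ≁ℓ a b (Equivalence.from (Adj⇔ _ _) (ℓa≢ℓb , ℓa∩ℓb))) z∈) y∈
      }

  ∣L∣<∣X∣ : ∀ {X c L} → IsStar X c L → ∣ L ∣ < ∣ X ∣
  ∣L∣<∣X∣ star = p⊂q⇒∣p∣<∣q∣ (leaves⊆ star , _ , centre∈ star , centre∉ star)

  Independent-⊆ : ∀ {L L′} → L′ ⊆ L → Independent L → Independent L′
  Independent-⊆ L′⊆L indep y∈ z∈ = indep (L′⊆L y∈) (L′⊆L z∈)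

  ∣Independent∩Clique∣≤1 : ∀ {L K} → Independent L →
                           (∀ {y z} → y ∈ K → z ∈ K → Intersect (I y) (I z)) → ∣ L ∩ K ∣ ≤ 1
  ∣Independent∩Clique∣≤1 indep clique = subsingleton⇒∣p∣≤1 λ {y} {z} y∈ z∈ →
    let (y∈L , y∈K) = ∈∩⁻ y∈ ; (z∈L , z∈K) = ∈∩⁻ z∈ in
    decidable-stable (y Fin.≟ z) (λ y≢z → indep y∈L z∈L y≢z (clique y∈K z∈K))

-- Lower bound

*-bound : ∀ {m a b S r d} → m ≤ a + b → a ≤ 1 → b * S ≤ r → S ≤ d → m * S ≤ d + r
*-bound {m} {a} {b} {S} {r} {d} m≤a+b a≤1 bS≤r S≤d = begin
  m * S         ≤⟨ ℕ.*-monoˡ-≤ S m≤a+b ⟩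
  (a + b) * S   ≡⟨ ℕ.*-distribʳ-+ S a b ⟩
  a * S + b * S ≤⟨ ℕ.+-mono-≤ (ℕ.*-monoˡ-≤ S a≤1) bS≤r ⟩
  1 * S + r     ≡⟨ cong (_+ r) (ℕ.*-identityˡ S) ⟩
  S + r         ≤⟨ ℕ.+-monoˡ-≤ r S≤d ⟩
  d + r         ∎
  where open ℕ.≤-Reasoning

module Sweeping {n : ℕ} (I : Fin n → OpenInterval) (s : ℕ) where

  open Stars I

  Block : (R A : Subset n) → (Fin n → ℕ) → ℕ → Subset n
  Block R A block b = (R ∩ ∁ A) ∩ preimage ℕ._≟_ block b

  Block⊆R : ∀ {R A block b} → Block R A block b ⊆ R
  Block⊆R = proj₁ ∘ ∈∩⁻ ∘ proj₁ ∘ ∈∩⁻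

  -- A gets one colour; the rest of R falls into mutually non-adjacent blocks of at most s vertices,
  -- coloured recursively. A is a union of cliques, one per cut, and each cut uses up s+1 vertices
  -- of R: this is what indep-A and star-A record.
  record Sweep (R : Subset n) : Set where
    field
      A            : Subset n
      block        : Fin n → ℕ
      A⊆R          : A ⊆ R
      ∣Block∣≤s    : ∀ b → ∣ Block R A block b ∣ ≤ s
      block-closed : ∀ {y z} → y ∈ R ∩ ∁ A → z ∈ R ∩ ∁ A → Intersect (I y) (I z) → block y ≡ block z
      indep-A      : ∀ {L} → L ⊆ A → Independent L → ∣ L ∣ * suc s ≤ ∣ R ∣
      star-A       : ∀ {c L} → IsStar A c L → ∣ L ∣ ≤ 1 ⊎ ∣ L ∣ * suc s < ∣ R ∣

  small-sweep : ∀ R → ∣ R ∣ ≤ s → Sweep R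
  small-sweep R ∣R∣≤s = record
    { A            = ∅
    ; block        = λ _ → 0
    ; A⊆R          = ⊆-min R
    ; ∣Block∣≤s    = λ b → ℕ.≤-trans (p⊆q⇒∣p∣≤∣q∣ (Block⊆R {R} {∅} {λ _ → 0} {b})) ∣R∣≤s
    ; block-closed = λ _ _ _ → refl
    ; indep-A      = λ L⊆∅ _ → subst (λ m → m * suc s ≤ ∣ R ∣)
                       (sym (Empty⇒∣p∣≡0 λ (_ , y∈L) → ∉⊥ (L⊆∅ y∈L))) z≤n
    ; star-A       = λ star → contradiction (centre∈ star) ∉⊥
    }

  module Cut (R : Subset n) (x : ℚ) where

    Before UpTo Across After : Subset n
    Before = R ∩ Below (hi ∘ I) x
    UpTo   = R ∩ AtMost (hi ∘ I) x
    Across = R ∩ ⟦ (λ y → lo (I y) ℚ.<? x ×-dec x ℚ.≤? hi (I y)) ⟧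
    After  = R ∩ ⟦ (λ y → x ℚ.≤? lo (I y)) ⟧

    module _ {y : Fin n} where

      ∈Before⁻ : y ∈ Before → y ∈ R × hi (I y) ℚ.< x
      ∈Before⁻ y∈ = let (y∈R , y∈Below) = ∈∩⁻ y∈ in y∈R , ∈Below⁻ y∈Below

      ∈UpTo⁻ : y ∈ UpTo → y ∈ R × hi (I y) ℚ.≤ x
      ∈UpTo⁻ y∈ = let (y∈R , y∈AtMost) = ∈∩⁻ y∈ in y∈R , ∈AtMost⁻ y∈AtMost

      ∈Across⁺ : y ∈ R → lo (I y) ℚ.< x → x ℚ.≤ hi (I y) → y ∈ Across
      ∈Across⁺ y∈R lo<x x≤hi =
        x∈p∩q⁺ (y∈R , ∈⟦⟧⁺ (λ y → lo (I y) ℚ.<? x ×-dec x ℚ.≤? hi (I y)) (lo<x , x≤hi))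

      ∈Across⁻ : y ∈ Across → y ∈ R × lo (I y) ℚ.< x × x ℚ.≤ hi (I y)
      ∈Across⁻ y∈ = let (y∈R , y∈′) = ∈∩⁻ y∈ in
        y∈R , ∈⟦⟧⁻ (λ y → lo (I y) ℚ.<? x ×-dec x ℚ.≤? hi (I y)) y∈′

      ∈After⁺ : y ∈ R → x ℚ.≤ lo (I y) → y ∈ After
      ∈After⁺ y∈R x≤lo = x∈p∩q⁺ (y∈R , ∈⟦⟧⁺ (λ y → x ℚ.≤? lo (I y)) x≤lo)

      ∈After⁻ : y ∈ After → y ∈ R × x ℚ.≤ lo (I y)
      ∈After⁻ y∈ = let (y∈R , y∈′) = ∈∩⁻ y∈ in y∈R , ∈⟦⟧⁻ (λ y → x ℚ.≤? lo (I y)) y∈′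

    classify : ∀ {y} → y ∈ R → y ∈ Before ⊎ y ∈ Across ⊎ y ∈ After
    classify {y} y∈R with hi (I y) ℚ.<? x | lo (I y) ℚ.<? x
    ... | yes hi<x | _        = inj₁ (x∈p∩q⁺ (y∈R , ∈Below⁺ hi<x))
    ... | no hi≮x  | yes lo<x = inj₂ (inj₁ (∈Across⁺ y∈R lo<x (ℚ.≮⇒≥ hi≮x)))
    ... | no _     | no lo≮x  = inj₂ (inj₂ (∈After⁺ y∈R (ℚ.≮⇒≥ lo≮x)))

    Across-clique : ∀ {y z} → y ∈ Across → z ∈ Across → Intersect (I y) (I z)
    Across-clique {y} {z} y∈ z∈ =
      let (_ , loy<x , x≤hiy) = ∈Across⁻ y∈ ; (_ , loz<x , x≤hiz) = ∈Across⁻ z∈ in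
      lo<hi⇒Intersect (I y) (I z) (ℚ.<-≤-trans loy<x x≤hiz) (ℚ.<-≤-trans loz<x x≤hiy)

    Before-After-apart : ∀ {y z} → y ∈ Before → z ∈ After → ¬ Intersect (I y) (I z)
    Before-After-apart {y} {z} y∈ z∈ y∩z =
      <⇒≱ (ℚ.<-trans (proj₂ (Intersect⇒lo<hi (I y) (I z) y∩z)) (proj₂ (∈Before⁻ y∈)))
          (proj₂ (∈After⁻ z∈))

    After⇒hi≰x : ∀ {y} → y ∈ After → ¬ hi (I y) ℚ.≤ x
    After⇒hi≰x {y} y∈ hi≤x = <⇒≱ (lo<hi (I y)) (ℚ.≤-trans hi≤x (proj₂ (∈After⁻ y∈)))

    ∣UpTo∣+∣After∣≡∣UpTo∪After∣ : ∣ UpTo ∣ + ∣ After ∣ ≡ ∣ UpTo ∪ After ∣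
    ∣UpTo∣+∣After∣≡∣UpTo∪After∣ = Empty[p∩q]⇒∣p∣+∣q∣≡∣p∪q∣ λ (y , y∈) →
      let (y∈UpTo , y∈After) = ∈∩⁻ y∈ in After⇒hi≰x y∈After (proj₂ (∈UpTo⁻ y∈UpTo))

    UpTo∪After⊆R : UpTo ∪ After ⊆ R
    UpTo∪After⊆R y∈ = [ proj₁ ∘ ∈UpTo⁻ , proj₁ ∘ ∈After⁻ ]′ (∈∪⁻ y∈)

    ∣UpTo∣+∣After∣≤∣R∣ : ∣ UpTo ∣ + ∣ After ∣ ≤ ∣ R ∣
    ∣UpTo∣+∣After∣≤∣R∣ =
      subst (_≤ ∣ R ∣) (sym ∣UpTo∣+∣After∣≡∣UpTo∪After∣) (p⊆q⇒∣p∣≤∣q∣ UpTo∪After⊆R)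

    ∣UpTo∣+∣After∣<∣R∣ : ∀ {c} → c ∈ R → lo (I c) ℚ.< x → x ℚ.< hi (I c) →
                         ∣ UpTo ∣ + ∣ After ∣ < ∣ R ∣
    ∣UpTo∣+∣After∣<∣R∣ {c} c∈R lo<x x<hi = subst (_< ∣ R ∣) (sym ∣UpTo∣+∣After∣≡∣UpTo∪After∣)
      (p⊂q⇒∣p∣<∣q∣ (UpTo∪After⊆R , c , c∈R , λ c∈ →
        [ (λ c∈UpTo → <⇒≱ x<hi (proj₂ (∈UpTo⁻ c∈UpTo)))
        , (λ c∈After → <⇒≱ lo<x (proj₂ (∈After⁻ c∈After))) ]′ (∈∪⁻ c∈)))

    After⊂R : 0 < ∣ UpTo ∣ → After ⊂ R
    After⊂R 0<∣UpTo∣ with 0<∣p∣⇒Nonempty UpTo 0<∣UpTo∣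
    ... | y , y∈UpTo = proj₁ ∘ ∈After⁻ , y , proj₁ (∈UpTo⁻ y∈UpTo) ,
                       λ y∈After → After⇒hi≰x y∈After (proj₂ (∈UpTo⁻ y∈UpTo))

  module Step {R : Subset n} {x : ℚ}
              (∣Before∣≤s : ∣ Cut.Before R x ∣ ≤ s) (s<∣UpTo∣ : s < ∣ Cut.UpTo R x ∣)
              (rest : Sweep (Cut.After R x)) where

    open Cut R x

    module Rest = Sweep rest

    A : Subset n
    A = Across ∪ Rest.A

    block : Fin n → ℕ
    block y = if does (hi (I y) ℚ.<? x) then 0 else suc (Rest.block y)

    block-Before : ∀ {y} → y ∈ Before → block y ≡ 0
    block-Before {y} y∈ = cong (λ b → if b then 0 else suc (Rest.block y))
      (dec-true (hi (I y) ℚ.<? x) (proj₂ (∈Before⁻ y∈)))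

    block-After : ∀ {y} → y ∈ After → block y ≡ suc (Rest.block y)
    block-After {y} y∈ = cong (λ b → if b then 0 else suc (Rest.block y))
      (dec-false (hi (I y) ℚ.<? x) (After⇒hi≰x y∈ ∘ ℚ.<⇒≤))

    outside-A : ∀ {y} → y ∈ R ∩ ∁ A → y ∈ Before ⊎ y ∈ After ∩ ∁ Rest.A
    outside-A y∈ with ∈∩⁻ y∈
    ... | y∈R , y∉A with classify y∈R
    ...   | inj₁ y∈Before         = inj₁ y∈Before
    ...   | inj₂ (inj₁ y∈Across)  = contradiction (x∈p∪q⁺ (inj₁ y∈Across)) (x∈∁p⇒x∉p y∉A)
    ...   | inj₂ (inj₂ y∈After)   =
      inj₂ (x∈p∩q⁺ (y∈After , x∉p⇒x∈∁p λ y∈A′ → x∈∁p⇒x∉p y∉A (x∈p∪q⁺ (inj₂ y∈A′))))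

    ∣Block∣≤s : ∀ b → ∣ Block R A block b ∣ ≤ s
    ∣Block∣≤s zero    = ℕ.≤-trans (p⊆q⇒∣p∣≤∣q∣ Block⊆Before) ∣Before∣≤s
      where
      Block⊆Before : Block R A block 0 ⊆ Before
      Block⊆Before y∈ with ∈∩⁻ y∈
      ... | y∈R∖A , block≡0 with outside-A y∈R∖A
      ...   | inj₁ y∈Before = y∈Before
      ...   | inj₂ y∈After∖A′ = contradiction
        (trans (sym (block-After (proj₁ (∈∩⁻ y∈After∖A′)))) (∈preimage⁻ ℕ._≟_ block 0 block≡0))
        (λ ())
    ∣Block∣≤s (suc b) = ℕ.≤-trans (p⊆q⇒∣p∣≤∣q∣ Block⊆Rest) (Rest.∣Block∣≤s b)
      where
      Block⊆Rest : Block R A block (suc b) ⊆ Block After Rest.A Rest.block b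
      Block⊆Rest y∈ with ∈∩⁻ y∈
      ... | y∈R∖A , block≡b+1 with outside-A y∈R∖A | ∈preimage⁻ ℕ._≟_ block (suc b) block≡b+1
      ...   | inj₁ y∈Before   | block≡ =
        contradiction (trans (sym (block-Before y∈Before)) block≡) (λ ())
      ...   | inj₂ y∈After∖A′ | block≡ = x∈p∩q⁺ (y∈After∖A′ , ∈preimage⁺ ℕ._≟_ Rest.block b
              (ℕ.suc-injective (trans (sym (block-After (proj₁ (∈∩⁻ y∈After∖A′)))) block≡)))

    block-closed : ∀ {y z} → y ∈ R ∩ ∁ A → z ∈ R ∩ ∁ A → Intersect (I y) (I z) → block y ≡ block z
    block-closed {y} {z} y∈ z∈ y∩z with outside-A y∈ | outside-A z∈
    ... | inj₁ y∈Before | inj₁ z∈Before =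
      trans (block-Before y∈Before) (sym (block-Before z∈Before))
    ... | inj₁ y∈Before | inj₂ z∈After∖A′ =
      contradiction y∩z (Before-After-apart y∈Before (proj₁ (∈∩⁻ z∈After∖A′)))
    ... | inj₂ y∈After∖A′ | inj₁ z∈Before =
      contradiction (Intersect-sym (I y) (I z) y∩z)
                    (Before-After-apart z∈Before (proj₁ (∈∩⁻ y∈After∖A′)))
    ... | inj₂ y∈After∖A′ | inj₂ z∈After∖A′ =
      trans (block-After (proj₁ (∈∩⁻ y∈After∖A′)))
        (trans (cong suc (Rest.block-closed y∈After∖A′ z∈After∖A′ y∩z))
               (sym (block-After (proj₁ (∈∩⁻ z∈After∖A′)))))

    ∣L∣≤∣L∩Across∣+∣L∩A′∣ : ∀ {L} → L ⊆ A → ∣ L ∣ ≤ ∣ L ∩ Across ∣ + ∣ L ∩ Rest.A ∣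
    ∣L∣≤∣L∩Across∣+∣L∩A′∣ L⊆A = p⊆q∪r⇒∣p∣≤∣p∩q∣+∣p∩r∣ L⊆A

    indep-bound : ∀ {L} → L ⊆ A → Independent L → ∣ L ∣ * suc s ≤ ∣ UpTo ∣ + ∣ After ∣
    indep-bound {L} L⊆A indep = *-bound (∣L∣≤∣L∩Across∣+∣L∩A′∣ L⊆A)
      (∣Independent∩Clique∣≤1 indep Across-clique)
      (Rest.indep-A (proj₂ ∘ ∈∩⁻) (Independent-⊆ (proj₁ ∘ ∈∩⁻) indep))
      s<∣UpTo∣

    crossing-bound : ∀ {c L y} → IsStar A c L → y ∈ R → lo (I y) ℚ.< x → x ℚ.< hi (I y) →
                     ∣ L ∣ * suc s < ∣ R ∣
    crossing-bound star y∈R lo<x x<hi = ℕ.≤-<-trans (indep-bound (leaves⊆ star) (independent star))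
                                                    (∣UpTo∣+∣After∣<∣R∣ y∈R lo<x x<hi)

    star-Across : ∀ {c L} → IsStar A c L → c ∈ Across → ∣ L ∣ ≤ 1 ⊎ ∣ L ∣ * suc s < ∣ R ∣
    star-Across {c} {L} star c∈Across with nonempty? (L ∩ Rest.A)
    ... | no L∩A′=∅ = inj₁ (ℕ.≤-trans (∣L∣≤∣L∩Across∣+∣L∩A′∣ (leaves⊆ star))
            (ℕ.+-mono-≤ (∣Independent∩Clique∣≤1 (independent star) Across-clique)
                        (ℕ.≤-reflexive (Empty⇒∣p∣≡0 L∩A′=∅))))
    ... | yes (z , z∈L∩A′) =
      let (z∈L , z∈A′) = ∈∩⁻ z∈L∩A′
          (c∈R , loc<x , _) = ∈Across⁻ c∈Across
          x≤loz = proj₂ (∈After⁻ (Rest.A⊆R z∈A′))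
          loz<hic = proj₂ (Intersect⇒lo<hi (I c) (I z) (meets star z∈L))
      in inj₂ (crossing-bound star c∈R loc<x (ℚ.≤-<-trans x≤loz loz<hic))

    star-Rest : ∀ {c L} → IsStar A c L → c ∈ Rest.A → ∣ L ∣ ≤ 1 ⊎ ∣ L ∣ * suc s < ∣ R ∣
    star-Rest {c} {L} star c∈A′ with nonempty? (L ∩ Across)
    ... | yes (y , y∈L∩Across) =
      let (y∈L , y∈Across) = ∈∩⁻ y∈L∩Across
          (y∈R , loy<x , _) = ∈Across⁻ y∈Across
          x≤loc = proj₂ (∈After⁻ (Rest.A⊆R c∈A′))
          loc<hiy = proj₁ (Intersect⇒lo<hi (I c) (I y) (meets star y∈L))
      in inj₂ (crossing-bound star y∈R loy<x (ℚ.≤-<-trans x≤loc loc<hiy))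
    ... | no L∩Across=∅ =
      Sum.map₂ (λ <∣After∣ → ℕ.<-≤-trans <∣After∣ (p⊆q⇒∣p∣≤∣q∣ (proj₁ ∘ ∈After⁻)))
               (Rest.star-A (IsStar-⊆ c∈A′ L⊆A′ star))
      where
      L⊆A′ : L ⊆ Rest.A
      L⊆A′ {y} y∈L =
        [ (λ y∈Across → contradiction (y , x∈p∩q⁺ (y∈L , y∈Across)) L∩Across=∅) , id ]′
        (∈∪⁻ (leaves⊆ star y∈L))

    sweep : Sweep R
    sweep = record
      { A            = A
      ; block        = block
      ; A⊆R          = [ proj₁ ∘ ∈Across⁻ , proj₁ ∘ ∈After⁻ ∘ Rest.A⊆R ]′ ∘ ∈∪⁻
      ; ∣Block∣≤s    = ∣Block∣≤s
      ; block-closed = block-closed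
      ; indep-A      = λ L⊆A indep → ℕ.≤-trans (indep-bound L⊆A indep) ∣UpTo∣+∣After∣≤∣R∣
      ; star-A       = λ star → [ star-Across star , star-Rest star ]′ (∈∪⁻ (centre∈ star))
      }

  sweep : ∀ R → Sweep R
  sweep = All.wfRec ⊂-wellFounded 0ℓ Sweep go
    where
    go : ∀ R → (∀ {R′} → R′ ⊂ R → Sweep R′) → Sweep R
    go R rec with ∣ R ∣ ≤? s
    ... | yes ∣R∣≤s = small-sweep R ∣R∣≤s
    ... | no ∣R∣≰s with threshold {p = R} (hi ∘ I) s (ℕ.≰⇒> ∣R∣≰s)
    ...   | x , ∣Before∣≤s , s<∣UpTo∣ =
      Step.sweep {R} {x} ∣Before∣≤s s<∣UpTo∣ (rec (Cut.After⊂R R x (ℕ.≤-<-trans z≤n s<∣UpTo∣)))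

μ : ℕ → ℕ → ℕ
μ v zero    = 0
μ v (suc k) = suc v * suc (μ v k)

μ-closed-form : ∀ v k → v * μ v k + suc v ≡ suc v ^ suc k
μ-closed-form v zero    = trans (cong (_+ suc v) (ℕ.*-zeroʳ v)) (sym (ℕ.*-identityʳ (suc v)))
μ-closed-form v (suc k) = begin
  v * (suc v * suc (μ v k)) + suc v ≡⟨ distribute v (μ v k) ⟩
  suc v * (v * μ v k + suc v)       ≡⟨ cong (suc v *_) (μ-closed-form v k) ⟩
  suc v * suc v ^ suc k             ∎
  where
  open ≡-Reasoning
  distribute : ∀ v m → v * (suc v * suc m) + suc v ≡ suc v * (v * m + suc v)
  distribute = solve-∀

μ-formula : ∀ k v (hv : 1 ≤ v) → _/_ ((v + 1) ^ (k + 1) ∸ (v + 1)) v {{>-nonZero hv}} ≡ μ v k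
μ-formula k v hv = begin
  ((v + 1) ^ (k + 1) ∸ (v + 1)) / v ≡⟨ cong (λ m → (m ∸ (v + 1)) / v) (cong₂ _^_ v+1≡ k+1≡) ⟩
  (suc v ^ suc k ∸ (v + 1)) / v     ≡⟨ cong (λ m → (suc v ^ suc k ∸ m) / v) v+1≡ ⟩
  (suc v ^ suc k ∸ suc v) / v       ≡⟨ cong (λ m → (m ∸ suc v) / v) (sym (μ-closed-form v k)) ⟩
  (v * μ v k + suc v ∸ suc v) / v   ≡⟨ cong (_/ v) (ℕ.m+n∸n≡m (v * μ v k) (suc v)) ⟩
  (v * μ v k) / v                   ≡⟨ cong (_/ v) (ℕ.*-comm v (μ v k)) ⟩
  (μ v k * v) / v                   ≡⟨ m*n/n≡m (μ v k) v ⟩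
  μ v k                             ∎
  where
  open ≡-Reasoning
  instance
    v≢0 : NonZero v
    v≢0 = >-nonZero hv
  v+1≡ = ℕ.+-comm v 1
  k+1≡ = ℕ.+-comm k 1

module LowerBound {n : ℕ} (I : Fin n → OpenInterval) {v : ℕ} (1≤v : 1 ≤ v) where

  open Stars I

  colour : ∀ k R → ∣ R ∣ ≤ μ v (suc k) → Colouring v (suc k) R
  colour zero R ∣R∣≤v+1 = (λ _ → zero) , λ { zero star → s≤s⁻¹ (ℕ.<-≤-trans (∣L∣<∣X∣ star)
    (ℕ.≤-trans (∣p∩q∣≤∣p∣ R _) (subst (∣ R ∣ ≤_) (ℕ.*-identityʳ (suc v)) ∣R∣≤v+1))) }
  colour (suc k) R ∣R∣≤ = col , bounded
    where
    open Sweeping I (μ v (suc k))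
    open Sweep (sweep R)

    sub : ∀ b → Colouring v (suc k) (Block R A block b)
    sub b = colour k (Block R A block b) (∣Block∣≤s b)

    col : Fin n → Fin (suc (suc k))
    col y = if does (y ∈? A) then zero else suc (proj₁ (sub (block y)) y)

    Class : Fin (suc (suc k)) → Subset n
    Class p = R ∩ preimage Fin._≟_ col p

    col-spec : ∀ y → y ∈ A × col y ≡ zero ⊎ y ∉ A × col y ≡ suc (proj₁ (sub (block y)) y)
    col-spec y with y ∈? A
    ... | yes y∈A = inj₁ (y∈A , refl)
    ... | no y∉A  = inj₂ (y∉A , refl)

    Class0⊆A : Class zero ⊆ A
    Class0⊆A {y} y∈ with col-spec y
    ... | inj₁ (y∈A , _)     = y∈A
    ... | inj₂ (_ , col≡suc) =
      contradiction (trans (sym col≡suc) (∈preimage⁻ Fin._≟_ col zero (proj₂ (∈∩⁻ y∈)))) λ ()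

    in-Block : ∀ {y q} → y ∈ Class (suc q) → y ∈ R ∩ ∁ A × proj₁ (sub (block y)) y ≡ q
    in-Block {y} {q} y∈ with ∈∩⁻ y∈ | col-spec y
    ... | _ , col≡q+1 | inj₁ (_ , col≡0) =
      contradiction (trans (sym col≡0) (∈preimage⁻ Fin._≟_ col (suc q) col≡q+1)) λ ()
    ... | y∈R , col≡q+1 | inj₂ (y∉A , col≡suc) =
      x∈p∩q⁺ (y∈R , x∉p⇒x∈∁p y∉A) ,
      Fin.suc-injective (trans (sym col≡suc) (∈preimage⁻ Fin._≟_ col (suc q) col≡q+1))

    bounded : ∀ p → ClawBounded v (Class p)
    bounded zero star =
      [ (λ ∣L∣≤1 → ℕ.≤-trans ∣L∣≤1 1≤v)
      , (λ ∣L∣S<∣R∣ → s≤s⁻¹ (ℕ.*-cancelʳ-< _ _ _ (ℕ.<-≤-trans ∣L∣S<∣R∣ ∣R∣≤))) ]′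
      (star-A (IsStar-⊆ (Class0⊆A (centre∈ star)) (Class0⊆A ∘ leaves⊆ star) star))
    bounded (suc q) {c} {L} star =
      proj₂ (sub (block c)) q (IsStar-⊆ (into (centre∈ star) refl) L⊆ star)
      where
      SubClass : Subset n
      SubClass = Block R A block (block c) ∩ preimage Fin._≟_ (proj₁ (sub (block c))) q
      into : ∀ {y} → y ∈ Class (suc q) → block y ≡ block c → y ∈ SubClass
      into {y} y∈ block≡ with in-Block y∈
      ... | y∈R∖A , col≡q = x∈p∩q⁺
        ( x∈p∩q⁺ (y∈R∖A , ∈preimage⁺ ℕ._≟_ block (block c) block≡)
        , ∈preimage⁺ Fin._≟_ _ q (subst (λ b → proj₁ (sub b) y ≡ q) block≡ col≡q))
      L⊆ : L ⊆ SubClass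
      L⊆ y∈L = into (leaves⊆ star y∈L) (sym (block-closed (proj₁ (in-Block (centre∈ star)))
                                                          (proj₁ (in-Block (leaves⊆ star y∈L)))
                                                          (meets star y∈L)))

lower-bound : ∀ {k v} → 1 ≤ k → 1 ≤ v → AllIntervalPartitionable k v (μ v k)
lower-bound {suc k} {v} _ 1≤v G (I , Adj⇔) = col , λ p → ClawBounded⇒ClawNumber≤ G Adj⇔
  (λ col≡p → x∈p∩q⁺ (∈⊤ , ∈preimage⁺ Fin._≟_ col p col≡p)) (bounded p)
  where
  open Stars I
  colouring = LowerBound.colour I 1≤v k ∅ᶜ (ℕ.≤-reflexive (∣⊤∣≡n (μ v (suc k))))
  col = proj₁ colouring
  bounded = proj₂ colouring

-- Upper bound

record Span : Set where
  field
    left right : ℕ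
    left<right : left < right

open Span

shift : ℕ → Span → Span
shift t X = record
  { left = t + left X ; right = t + right X ; left<right = ℕ.+-monoʳ-< t (left<right X) }

Overlap : Span → Span → Set
Overlap X Y = left X < right Y × left Y < right X

apart : ∀ {X Y} → right X ≤ left Y → ¬ Overlap X Y
apart rX≤lY (_ , lY<rX) = ℕ.<-irrefl refl (ℕ.<-≤-trans lY<rX rX≤lY)

Overlap-shift : ∀ t X Y → Overlap X Y ⇔ Overlap (shift t X) (shift t Y)
Overlap-shift t X Y = mk⇔ (λ (lX<rY , lY<rX) → ℕ.+-monoʳ-< t lX<rY , ℕ.+-monoʳ-< t lY<rX)
                      (λ (lX<rY , lY<rX) → ℕ.+-cancelˡ-< t _ _ lX<rY , ℕ.+-cancelˡ-< t _ _ lY<rX)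

right-shift≤ : ∀ b w X → right X ≤ w → right (shift (b * w) X) ≤ suc b * w
right-shift≤ b w X rX≤w = ℕ.≤-trans (ℕ.+-monoʳ-≤ (b * w) rX≤w) (ℕ.≤-reflexive (ℕ.+-comm (b * w) w))

toℚ : ℕ → ℚ
toℚ m = fromℤ (ℤ.+ m)

toℚ-mono-< : ∀ {a b} → a < b → toℚ a ℚ.< toℚ b
toℚ-mono-< a<b = ℚ.*<* (subst₂ ℤ._<_ (sym (ℤ.*-identityʳ _)) (sym (ℤ.*-identityʳ _)) (ℤ.+<+ a<b))

toℚ-cancel-< : ∀ {a b} → toℚ a ℚ.< toℚ b → a < b
toℚ-cancel-< (ℚ.*<* a<b) = ℤ.drop‿+<+ (subst₂ ℤ._<_ (ℤ.*-identityʳ _) (ℤ.*-identityʳ _) a<b)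

toInterval : Span → OpenInterval
toInterval X = ⟨ toℚ (left X) , toℚ (right X) , toℚ-mono-< (left<right X) ⟩

Intersect⇔Overlap : ∀ X Y → Intersect (toInterval X) (toInterval Y) ⇔ Overlap X Y
Intersect⇔Overlap X Y = mk⇔
  (Product.map toℚ-cancel-< toℚ-cancel-< ∘ Intersect⇒lo<hi (toInterval X) (toInterval Y))
  (λ (lX<rY , lY<rX) →
    lo<hi⇒Intersect (toInterval X) (toInterval Y) (toℚ-mono-< lX<rY) (toℚ-mono-< lY<rX))

clamp : ∀ {m n} → Fin n → Fin (suc m)
clamp {m} x = fromℕ< (s≤s (ℕ.m⊓n≤n (toℕ x) m))

clamp-inject≤ : ∀ {m n} (y : Fin (suc m)) (le : suc m ≤ n) → clamp (inject≤ y le) ≡ y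
clamp-inject≤ {m} y le = Fin.toℕ-injective (begin
  toℕ (clamp (inject≤ y le)) ≡⟨ Fin.toℕ-fromℕ< _ ⟩
  toℕ (inject≤ y le) ⊓ m     ≡⟨ cong (_⊓ m) (Fin.toℕ-inject≤ y le) ⟩
  toℕ y ⊓ m                  ≡⟨ ℕ.m≤n⇒m⊓n≡m (s≤s⁻¹ (Fin.toℕ<n y)) ⟩
  toℕ y                      ∎)
  where open ≡-Reasoning

module Tower (v : ℕ) where

  width : ℕ → ℕ
  width k = suc v ^ k

  Vertex : ℕ → Set
  Vertex k = Fin (suc (μ v k))

  -- Opaque, so that tower-copy can rewrite with unpack-combine before remQuot unfolds.
  opaque
    unpack : ∀ k → Fin (μ v (suc k)) → Fin (suc v) × Vertex k
    unpack k = remQuot (suc (μ v k))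

    unpack-combine : ∀ k b j → unpack k (combine b j) ≡ (b , j)
    unpack-combine k = Fin.remQuot-combine

  -- At level k+1, vertex zero is the root span [0, (v+1)^(k+1)] and copy k b j is vertex j of
  -- level k translated by b (v+1)^k.
  tower : ∀ k → Vertex k → Span
  tower zero    _       = record { left = 0 ; right = 1 ; left<right = s≤s z≤n }
  tower (suc k) zero    =
    record { left = 0 ; right = width (suc k) ; left<right = ℕ.m^n>0 (suc v) (suc k) }
  tower (suc k) (suc x) with unpack k x
  ... | b , j = shift (toℕ b * width k) (tower k j)

  interval : ∀ k → Vertex k → OpenInterval
  interval k = toInterval ∘ tower k

  TowerGraph : ∀ k → Graph (suc (μ v k))
  TowerGraph k = intersectionGraph (interval k)

  copy : ∀ k → Fin (suc v) → Vertex k → Vertex (suc k)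
  copy k b j = suc (combine b j)

  copy-injective : ∀ k b → Injective _≡_ _≡_ (copy k b)
  copy-injective k b {i} {j} e = Fin.combine-injectiveʳ b i b j (Fin.suc-injective e)

  tower-copy : ∀ k b j → tower (suc k) (copy k b j) ≡ shift (toℕ b * width k) (tower k j)
  tower-copy k b j rewrite unpack-combine k b j = refl

  right-tower≤width : ∀ k x → right (tower k x) ≤ width k
  right-tower≤width zero    _       = ℕ.≤-refl
  right-tower≤width (suc k) zero    = ℕ.≤-refl
  right-tower≤width (suc k) (suc x) with unpack k x
  ... | b , j = ℕ.≤-trans (right-shift≤ (toℕ b) (width k) (tower k j) (right-tower≤width k j))
                          (ℕ.*-monoˡ-≤ (width k) (Fin.toℕ<n b))

  left-copy : ∀ k b j → toℕ b * width k ≤ left (tower (suc k) (copy k b j))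
  left-copy k b j = subst (λ X → toℕ b * width k ≤ left X) (sym (tower-copy k b j)) (ℕ.m≤m+n _ _)

  right-copy : ∀ k b j → right (tower (suc k) (copy k b j)) ≤ suc (toℕ b) * width k
  right-copy k b j = subst (λ X → right X ≤ suc (toℕ b) * width k) (sym (tower-copy k b j))
                           (right-shift≤ (toℕ b) (width k) (tower k j) (right-tower≤width k j))

  root-meets-copy : ∀ k b j → Overlap (tower (suc k) zero) (tower (suc k) (copy k b j))
  root-meets-copy k b j = ℕ.≤-<-trans z≤n (left<right X) , ℕ.<-≤-trans (left<right X)
    (ℕ.≤-trans (right-copy k b j) (ℕ.*-monoˡ-≤ (width k) (Fin.toℕ<n b)))
    where X = tower (suc k) (copy k b j)

  copies-apart : ∀ k {b b′} j j′ → toℕ b < toℕ b′ →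
                 ¬ Overlap (tower (suc k) (copy k b j)) (tower (suc k) (copy k b′ j′))
  copies-apart k {b} {b′} j j′ b<b′ =
    apart {tower (suc k) (copy k b j)} {tower (suc k) (copy k b′ j′)}
    (ℕ.≤-trans (right-copy k b j) (ℕ.≤-trans (ℕ.*-monoˡ-≤ (width k) b<b′) (left-copy k b′ j′)))

  copy-embedding : ∀ k b {i j} → Graph.Adj (TowerGraph k) i j ⇔
                                 Graph.Adj (TowerGraph (suc k)) (copy k b i) (copy k b j)
  copy-embedding k b = intersectionGraph-embedding {I = interval k} {J = interval (suc k)}
    (copy k b) (copy-injective k b) shifted
    where
    t = toℕ b * width k
    shifted : ∀ {i j} → Intersect (interval k i) (interval k j) ⇔
                        Intersect (interval (suc k) (copy k b i)) (interval (suc k) (copy k b j))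
    shifted {i} {j} =
      subst₂ (λ X Y → Intersect (interval k i) (interval k j) ⇔
                      Intersect (toInterval X) (toInterval Y))
        (sym (tower-copy k b i)) (sym (tower-copy k b j))
        (⇔.trans (Intersect⇔Overlap (tower k i) (tower k j))
        (⇔.trans (Overlap-shift t (tower k i) (tower k j))
                 (⇔.sym (Intersect⇔Overlap (shift t (tower k i)) (shift t (tower k j))))))

  root-star : ∀ k (col : Vertex (suc k) → Fin (suc k)) →
              (∀ b → ∃ λ j → col (copy k b j) ≡ col zero) →
              HasInducedStarIn (TowerGraph (suc k)) (λ x → col x ≡ col zero) (suc v)
  root-star k col hit = zero , ℓ , refl , proj₂ ∘ hit , ℓ-injective , root~ℓ , ℓ≁ℓ
    where
    ℓ : Fin (suc v) → Vertex (suc k)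
    ℓ b = copy k b (proj₁ (hit b))
    span : Fin (suc v) → Span
    span b = tower (suc k) (ℓ b)
    ℓ-injective : Injective _≡_ _≡_ ℓ
    ℓ-injective e = Fin.combine-injectiveˡ _ _ _ _ (Fin.suc-injective e)
    root~ℓ : ∀ b → Graph.Adj (TowerGraph (suc k)) zero (ℓ b)
    root~ℓ b = Fin.0≢1+n , Equivalence.from (Intersect⇔Overlap (tower (suc k) zero) (span b))
                                            (root-meets-copy k b _)
    ℓ≁ℓ : ∀ a b → ¬ Graph.Adj (TowerGraph (suc k)) (ℓ a) (ℓ b)
    ℓ≁ℓ a b (ℓa≢ℓb , ℓa∩ℓb) with ℕ.<-cmp (toℕ a) (toℕ b)
    ... | tri< a<b _ _ = copies-apart k _ _ a<b ℓa⋈ℓb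
      where ℓa⋈ℓb = Equivalence.to (Intersect⇔Overlap (span a) (span b)) ℓa∩ℓb
    ... | tri≈ _ a≡b _ = ℓa≢ℓb (cong ℓ (Fin.toℕ-injective a≡b))
    ... | tri> _ _ b<a = copies-apart k _ _ b<a (swap ℓa⋈ℓb)
      where ℓa⋈ℓb = Equivalence.to (Intersect⇔Overlap (span a) (span b)) ℓa∩ℓb

  hits? : ∀ {k} (col : Vertex (suc k) → Fin (suc k)) b → Dec (∃ λ j → col (copy k b j) ≡ col zero)
  hits? {k} col b = Fin.any? (λ j → col (copy k b j) Fin.≟ col zero)

  monochromatic-star : ∀ k (col : Vertex k → Fin k) →
                       ∃ λ p → HasInducedStarIn (TowerGraph k) (λ x → col x ≡ p) (suc v)
  monochromatic-star zero col with col zero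
  ... | ()
  monochromatic-star (suc k) col with Fin.all? (hits? col)
  ... | yes hit = col zero , root-star k col hit
  ... | no ¬hit with Fin.¬∀⟶∃¬ _ _ (hits? col) ¬hit
  ...   | b , miss with monochromatic-star k (λ j → punchOut (λ e → miss (j , sym e)))
  ...     | p , star = punchIn (col zero) p
    , star-transfer {G = TowerGraph k} {H = TowerGraph (suc k)} (copy k b) (copy-injective k b)
        (copy-embedding k b)
        (λ col′≡p → trans (sym (Fin.punchIn-punchOut _)) (cong (punchIn (col zero)) col′≡p)) star

  padded-unpartitionable : ∀ k {n} (N≤n : suc (μ v k) ≤ n) →
                           ¬ PartitionableClaw (intersectionGraph (interval k ∘ clamp {n = n})) k v
  padded-unpartitionable k {n} N≤n (col , bounded) =
    ℕ.1+n≰n (bounded colour (suc v)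
      (star-transfer {G = TowerGraph k} {H = intersectionGraph J}
                     embed embed-injective embed-Adj⇔ id star))
    where
    embed : Vertex k → Fin n
    embed y = inject≤ y N≤n
    embed-injective : Injective _≡_ _≡_ embed
    embed-injective = Fin.inject≤-injective N≤n N≤n _ _
    J : Fin n → OpenInterval
    J = interval k ∘ clamp
    embed-Adj⇔ : ∀ {i j} → Graph.Adj (TowerGraph k) i j ⇔
                           Graph.Adj (intersectionGraph J) (embed i) (embed j)
    embed-Adj⇔ = intersectionGraph-embedding {I = interval k} {J = J} embed embed-injective
      λ {i} {j} → subst₂ (λ x y → Intersect (interval k i) (interval k j) ⇔
                                  Intersect (interval k x) (interval k y))
                         (sym (clamp-inject≤ i N≤n)) (sym (clamp-inject≤ j N≤n)) ⇔.refl
    colour = proj₁ (monochromatic-star k (col ∘ embed))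
    star = proj₂ (monochromatic-star k (col ∘ embed))

upper-bound : ∀ k v n → AllIntervalPartitionable k v n → n ≤ μ v k
upper-bound k v n partition with n ≤? μ v k
... | yes n≤μ = n≤μ
... | no n≰μ = contradiction (partition (intersectionGraph J) (intersectionGraph-isInterval J))
                             (padded-unpartitionable k (ℕ.≰⇒> n≰μ))
  where
  open Tower v
  J : Fin n → OpenInterval
  J = interval k ∘ clamp

theorem1 : (k v : ℕ) → 1 ≤ k → (hv : 1 ≤ v) →
    IsLargest (AllIntervalPartitionable k v)
      (_/_ ((v + 1) ^ (k + 1) ∸ (v + 1)) v {{>-nonZero hv}})
theorem1 k v 1≤k 1≤v = subst (IsLargest (AllIntervalPartitionable k v)) (sym (μ-formula k v 1≤v))
  (lower-bound 1≤k 1≤v , upper-bound k v)
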